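{- Let $\alpha$ be a shape and $p,q\ge1$. If $i\ne j$ are in $\{1,\dots,p\}$ and $r\ne s$ are in $\{1,\dots,q\}$, then $\mathtt{switch}(\underline i,r)\circ\mathtt{switch}(\underline j,s)=\mathtt{switch}(\underline j,s)\circ\mathtt{switch}(\underline i,r)$ as maps on $\mathtt{Mixedtab}(\alpha,p,q)$.
   Context: $\mathtt{Mixedtab}(\alpha,p,q)$ consists of the null tableau $\emptyset$ together with all fillings of every box of the shape $\alpha$ with an entry from $\{\underline1,\dots,\underline p\}$ or from $\{1,\dots,q\}$ such that no label occurs twice in a row or in a column (no increasingness is required). For $T\ne\emptyset$, $\mathtt{switch}(\underline i,j)(T)$ is obtained by considering the set of boxes of $T$ containing $\underline i$ or $j$ and, in each connected (edge-adjacent) component of this set having more than one box, interchanging the $\underline i$'s and the $j$'s; if the result is in $\mathtt{Mixedtab}(\alpha,p,q)$ as a non-null filling it is the output, otherwise the output is $\emptyset$. Also $\mathtt{switch}(\underline i,j)(\emptyset)=\emptyset$. -}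

module Defs where

open import Data.Nat using (ℕ; zero; suc; _≤_; _<_; _≥_)
import Data.Nat.Properties as ℕP
open import Data.Fin using (Fin)
import Data.Fin.Properties as FinP
open import Data.List using (List; []; _∷_; filterᵇ; concatMap; map; upTo; length)
open import Data.Bool.ListAction using (any)
open import Data.List.Relation.Unary.All using (All)
import Data.List.Relation.Unary.All as All
open import Data.List.Membership.Propositional using (_∈_)
open import Data.Maybe using (Maybe; just; nothing)
open import Data.Product using (_×_; _,_; proj₁; proj₂)
open import Data.Product.Properties using (≡-dec)
open import Data.Sum using (_⊎_; inj₁; inj₂)
open import Data.Bool using (Bool; true; false; _∨_; _∧_; if_then_else_)
open import Relation.Binary.PropositionalEquality using (_≡_; _≢_; refl)
open import Relation.Nullary using (Dec; yes; no; ¬_)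
open import Relation.Nullary.Decidable using (⌊_⌋; _⊎-dec_; _×-dec_; ¬?; _→-dec_)
open import Relation.Binary using (DecidableEquality)

-- i-th entry of a list of naturals, 0 beyond its length
at : List ℕ → ℕ → ℕ
at []       _       = 0
at (x ∷ xs) zero    = x
at (x ∷ xs) (suc r) = at xs r

data IsPartition : List ℕ → Set where
  []  : IsPartition []
  one : ∀ {a} → 1 ≤ a → IsPartition (a ∷ [])
  _∷_ : ∀ {a b l} → b ≤ a → IsPartition (b ∷ l) → IsPartition (a ∷ b ∷ l)

-- A shape α = λ/μ with μ ⊆ λ partitions (straight shapes: μ = []).
record Shape : Set where
  field
    outer   : List ℕ
    inner   : List ℕ
    outerP  : IsPartition outer
    innerP  : IsPartition inner
    inner⊆outer : ∀ r → at inner r ≤ at outer r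
open Shape public

-- boxes are (row , column), 0-indexed, English convention
Box : Set
Box = ℕ × ℕ

_≟B_ : DecidableEquality Box
_≟B_ = ≡-dec ℕP._≟_ ℕP._≟_

range : ℕ → ℕ → List ℕ
range a b = filterᵇ (λ c → ⌊ a ℕP.≤? c ⌋) (upTo b)

boxes : Shape → List Box
boxes α = concatMap (λ r → map (λ c → (r , c)) (range (at (inner α) r) (at (outer α) r)))
                    (upTo (length (outer α)))

_∈α_ : Box → Shape → Set
b ∈α α = b ∈ boxes α

_∈α?_ : (b : Box) (α : Shape) → Dec (b ∈α α)
b ∈α? α = DecMem._∈?_ b (boxes α)
  where import Data.List.Membership.DecPropositional _≟B_ as DecMem

-- Labels: barred 1..p (underline i) and unbarred 1..q

data Label (p q : ℕ) : Set where
  bar   : Fin p → Label p q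
  plain : Fin q → Label p q

_≟L_ : ∀ {p q} → DecidableEquality (Label p q)
bar i   ≟L bar j   with FinP._≟_ i j
... | yes refl = yes refl
... | no ne    = no (λ { refl → ne refl })
bar i   ≟L plain j = no (λ ())
plain i ≟L bar j   = no (λ ())
plain i ≟L plain j with FinP._≟_ i j
... | yes refl = yes refl
... | no ne    = no (λ { refl → ne refl })

-- a filling assigns a label to every box (values outside α are irrelevant)
Filling : ℕ → ℕ → Set
Filling p q = Box → Label p q

SameLine : Box → Box → Set
SameLine b b' = b ≢ b' × (proj₁ b ≡ proj₁ b' ⊎ proj₂ b ≡ proj₂ b')

ValidFilling : ∀ {p q} → Shape → Filling p q → Set
ValidFilling α T =
  All (λ b → All (λ b' → SameLine b b' → T b ≢ T b') (boxes α)) (boxes α)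

validFilling? : ∀ {p q} (α : Shape) (T : Filling p q) → Dec (ValidFilling α T)
validFilling? α T =
  All.all? (λ b → All.all? (λ b' →
     ((¬? (b ≟B b')) ×-dec (ℕP._≟_ (proj₁ b) (proj₁ b') ⊎-dec ℕP._≟_ (proj₂ b) (proj₂ b')))
       →-dec ¬? (T b ≟L T b')) (boxes α)) (boxes α)

-- Mixedtab(α,p,q): nothing = the null tableau ∅, just T = a valid filling
MixedTableau : ℕ → ℕ → Set
MixedTableau p q = Maybe (Filling p q)

InMixedtab : ∀ {p q} → Shape → MixedTableau p q → Set
InMixedtab α nothing  = Data.Unit.⊤
  where import Data.Unit
InMixedtab α (just T) = ValidFilling α T

data _≈[_]_ {p q} : MixedTableau p q → Shape → MixedTableau p q → Set where
  null≈ : ∀ {α} → nothing ≈[ α ] nothing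
  fill≈ : ∀ {α T U} → (∀ b → b ∈α α → T b ≡ U b) → just T ≈[ α ] just U

module _ {p q : ℕ} (α : Shape) (i : Fin p) (j : Fin q) where

  isIJ : Label p q → Bool
  isIJ l = ⌊ l ≟L bar i ⌋ ∨ ⌊ l ≟L plain j ⌋

  swapIJ : Label p q → Label p q
  swapIJ (bar k)   = if ⌊ FinP._≟_ k i ⌋ then plain j else bar k
  swapIJ (plain k) = if ⌊ FinP._≟_ k j ⌋ then bar i else plain k

  inS : Filling p q → Box → Bool
  inS T b = ⌊ b ∈α? α ⌋ ∧ isIJ (T b)

  neighbours : Box → List Box
  neighbours (r , c) = (suc r , c) ∷ (r , suc c) ∷ up r c ++' left r c
    where
      _++'_ : List Box → List Box → List Box
      _++'_ = Data.List._++_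
      up : ℕ → ℕ → List Box
      up zero    c = []
      up (suc r) c = (r , c) ∷ []
      left : ℕ → ℕ → List Box
      left r zero    = []
      left r (suc c) = (r , c) ∷ []

  -- the connected component of S_T containing b has more than one box,
  -- i.e. b ∈ S_T has an edge-neighbour in S_T
  inBigComponent : Filling p q → Box → Bool
  inBigComponent T b = inS T b ∧ any (inS T) (neighbours b)

  interchange : Filling p q → Filling p q
  interchange T b = if inBigComponent T b then swapIJ (T b) else T b

  switch : MixedTableau p q → MixedTableau p q
  switch nothing  = nothing
  switch (just T) with validFilling? α (interchange T)
  ... | yes _ = just (interchange T)
  ... | no  _ = nothing

-- Let I(ī,r) denote the filling-level interchange of ī and r inside the big
-- components of S_T(ī,r), so that switch(ī,r) = "apply I(ī,r), keep the result
-- only if it is a valid filling".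
--
-- Since i ≢ j and r ≢ s, the label pairs {ī,r} and {j̄,s} are
--     disjoint, and swapping j̄ ↔ s preserves membership in {ī,r}.
--   * Fillings.  Hence I(j̄,s) leaves the set S_T(ī,r) -- and therefore its big
--     components -- unchanged, and vice versa; at every box at most one of the
--     two interchanges acts, so I(ī,r) ∘ I(j̄,s) = I(j̄,s) ∘ I(ī,r) pointwise.
--     Moreover, validity of I(ī,r)(I(j̄,s) T) forces validity of I(j̄,s) T.
--   * Guarded operations.  For any two operations F, G on fillings that commute
--     pointwise and satisfy this inner-validity property, the validity-guarded
--     versions of F and G commute on Mixedtab.  Lemma 4.4 is this general fact
--     instantiated with the two interchanges.
module Submission where

open import Defs
open import Data.Nat using (ℕ; _≥_)
open import Data.Fin using (Fin)
import Data.Fin.Properties as FinP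
open import Data.Bool using (true; false; _∧_)
open import Data.Bool.Properties using (∧-zeroʳ; ∧-conicalˡ; ∧-conicalʳ)
open import Data.Bool.ListAction using (or)
open import Data.List.Properties using (map-cong)
open import Data.Maybe using (just; nothing)
open import Data.Sum using (_⊎_; inj₁; inj₂; [_,_]′)
open import Data.Empty using (⊥-elim)
open import Function using (_∘_)
open import Relation.Nullary using (yes; no; ¬_)
open import Relation.Nullary.Decidable using (⌊_⌋)
open import Relation.Binary.PropositionalEquality
  using (_≡_; _≢_; refl; sym; trans; cong; cong₂; subst₂)
import Data.List.Relation.Unary.All as All

true≢false : true ≢ false
true≢false ()

module _ {p q : ℕ} (α : Shape) where

  collisions-inherited : ∀ {V W₁ W₂ : Filling p q} → ValidFilling α W₁ → ValidFilling α W₂ →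
    (∀ b b' → V b ≡ V b' → W₁ b ≡ W₁ b' ⊎ W₂ b ≡ W₂ b') → ValidFilling α V
  collisions-inherited W₁-valid W₂-valid inherit =
    All.tabulate λ b∈ → All.tabulate λ b'∈ line Vb≡Vb' →
      [ All.lookup (All.lookup W₁-valid b∈) b'∈ line
      , All.lookup (All.lookup W₂-valid b∈) b'∈ line ]′ (inherit _ _ Vb≡Vb')

  valid-≗ : ∀ {V W : Filling p q} → (∀ b → V b ≡ W b) → ValidFilling α V → ValidFilling α W
  valid-≗ V≗W V-valid = collisions-inherited V-valid V-valid
    (λ b b' Wb≡Wb' → inj₁ (trans (V≗W b) (trans Wb≡Wb' (sym (V≗W b')))))

module Labels {p q : ℕ} (α : Shape) where

  data PairView (i : Fin p) (r : Fin q) : Label p q → Set where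
    is-bar   : PairView i r (bar i)
    is-plain : PairView i r (plain r)
    other    : ∀ {l} → l ≢ bar i → l ≢ plain r → PairView i r l

  pairView : ∀ i r (l : Label p q) → PairView i r l
  pairView i r l with l ≟L bar i | l ≟L plain r
  ... | yes refl | _        = is-bar
  ... | no _     | yes refl = is-plain
  ... | no l≢ī   | no l≢r   = other l≢ī l≢r

  module _ (i : Fin p) (r : Fin q) where

    isIJ-bar : isIJ α i r (bar i) ≡ true
    isIJ-bar with bar {p} {q} i ≟L bar i
    ... | yes _  = refl
    ... | no ī≢ī = ⊥-elim (ī≢ī refl)

    isIJ-plain : isIJ α i r (plain r) ≡ true
    isIJ-plain with plain {p} {q} r ≟L plain r
    ... | yes _  = refl
    ... | no r≢r = ⊥-elim (r≢r refl)

    isIJ-other : ∀ l → l ≢ bar i → l ≢ plain r → isIJ α i r l ≡ false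
    isIJ-other l l≢ī l≢r with l ≟L bar i | l ≟L plain r
    ... | yes l≡ī | _       = ⊥-elim (l≢ī l≡ī)
    ... | no _    | yes l≡r = ⊥-elim (l≢r l≡r)
    ... | no _    | no _    = refl

    swap-bar : swapIJ α i r (bar i) ≡ plain r
    swap-bar with FinP._≟_ i i
    ... | yes _  = refl
    ... | no i≢i = ⊥-elim (i≢i refl)

    swap-plain : swapIJ α i r (plain r) ≡ bar i
    swap-plain with FinP._≟_ r r
    ... | yes _  = refl
    ... | no r≢r = ⊥-elim (r≢r refl)

    swap-other : ∀ l → l ≢ bar i → l ≢ plain r → swapIJ α i r l ≡ l
    swap-other (bar k) k̄≢ī _ with FinP._≟_ k i
    ... | yes refl = ⊥-elim (k̄≢ī refl)
    ... | no _     = refl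
    swap-other (plain k) _ k≢r with FinP._≟_ k r
    ... | yes refl = ⊥-elim (k≢r refl)
    ... | no _     = refl

    swap-closed : ∀ l → isIJ α i r l ≡ true → isIJ α i r (swapIJ α i r l) ≡ true
    swap-closed l l∈ with pairView i r l
    ... | is-bar          rewrite swap-bar   = isIJ-plain
    ... | is-plain        rewrite swap-plain = isIJ-bar
    ... | other l≢ī l≢r   rewrite swap-other l l≢ī l≢r = l∈

    swap-outside : ∀ l → isIJ α i r l ≡ false → swapIJ α i r l ≡ l
    swap-outside l l∉ with pairView i r l
    ... | is-bar        = ⊥-elim (true≢false (trans (sym isIJ-bar) l∉))
    ... | is-plain      = ⊥-elim (true≢false (trans (sym isIJ-plain) l∉))
    ... | other l≢ī l≢r = swap-other l l≢ī l≢r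

  module _ {i j : Fin p} (i≢j : i ≢ j) {r s : Fin q} (r≢s : r ≢ s) where

    pairs-disjoint : ∀ l → isIJ α j s l ≡ true → isIJ α i r l ≡ false
    pairs-disjoint l l∈ with pairView j s l
    ... | is-bar        = isIJ-other i r (bar j) (λ { refl → i≢j refl }) (λ ())
    ... | is-plain      = isIJ-other i r (plain s) (λ ()) (λ { refl → r≢s refl })
    ... | other l≢j̄ l≢s = ⊥-elim (true≢false (trans (sym l∈) (isIJ-other j s l l≢j̄ l≢s)))

    -- Swapping j̄ ↔ s does not change membership in {ī , r}: labels of the
    -- pair {j̄ , s} stay in it (hence outside {ī , r}), the others are fixed.
    swap-preserves-other-pair : ∀ l → isIJ α i r (swapIJ α j s l) ≡ isIJ α i r l
    swap-preserves-other-pair l with isIJ α j s l in l∈?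
    ... | true  = trans (pairs-disjoint (swapIJ α j s l) (swap-closed j s l l∈?))
                        (sym (pairs-disjoint l l∈?))
    ... | false = cong (isIJ α i r) (swap-outside j s l l∈?)

module Interchange {p q : ℕ} (α : Shape) where
  open Labels {p} {q} α

  module _ (i : Fin p) (r : Fin q) (T : Filling p q) (b : Box) where

    big⇒inPair : inBigComponent α i r T b ≡ true → isIJ α i r (T b) ≡ true
    big⇒inPair big = ∧-conicalʳ _ _ (∧-conicalˡ (inS α i r T b) _ big)

    interchange-outside : isIJ α i r (T b) ≡ false → interchange α i r T b ≡ T b
    interchange-outside l∉ rewrite l∉ | ∧-zeroʳ ⌊ b ∈α? α ⌋ = refl

    interchange-preserves-pair : isIJ α i r (interchange α i r T b) ≡ isIJ α i r (T b)
    interchange-preserves-pair with inBigComponent α i r T b in big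
    ... | true  = trans (swap-closed i r (T b) (big⇒inPair big)) (sym (big⇒inPair big))
    ... | false = refl

  module _ {i j : Fin p} (i≢j : i ≢ j) {r s : Fin q} (r≢s : r ≢ s) (T : Filling p q) where

    inS-invariant : ∀ b → inS α i r (interchange α j s T) b ≡ inS α i r T b
    inS-invariant b = cong (⌊ b ∈α? α ⌋ ∧_) labels
      where
        labels : isIJ α i r (interchange α j s T b) ≡ isIJ α i r (T b)
        labels with inBigComponent α j s T b
        ... | true  = swap-preserves-other-pair i≢j r≢s (T b)
        ... | false = refl

    big-invariant : ∀ b → inBigComponent α i r (interchange α j s T) b ≡ inBigComponent α i r T b
    big-invariant b =
      cong₂ _∧_ (inS-invariant b) (cong or (map-cong inS-invariant (neighbours α i r b)))

  module _ {i j : Fin p} (i≢j : i ≢ j) {r s : Fin q} (r≢s : r ≢ s) where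

    -- The two interchanges commute: at each box at most one of them acts.
    interchange-commute : ∀ T b →
      interchange α i r (interchange α j s T) b ≡ interchange α j s (interchange α i r T) b
    interchange-commute T b
      rewrite big-invariant i≢j r≢s T b | big-invariant (i≢j ∘ sym) (r≢s ∘ sym) T b
      with inBigComponent α i r T b in bigᵢ | inBigComponent α j s T b in bigⱼ
    ... | true  | true  = ⊥-elim (true≢false (trans (sym (big⇒inPair i r T b bigᵢ))
                                    (pairs-disjoint i≢j r≢s (T b) (big⇒inPair j s T b bigⱼ))))
    ... | true  | false = refl
    ... | false | true  = refl
    ... | false | false = refl

    -- If T and I(ī , r)(I(j̄ , s) T) are valid, so is I(j̄ , s) T: two equal labels
    -- of I(j̄ , s) T either lie in {j̄ , s}, where I(ī , r) does not act, or lie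
    -- outside it, where I(j̄ , s) did not act.
    inner-valid : ∀ T → ValidFilling α T →
      ValidFilling α (interchange α i r (interchange α j s T)) → ValidFilling α (interchange α j s T)
    inner-valid T T-valid U-valid = collisions-inherited α U-valid T-valid collision
      where
        V : Filling p q
        V = interchange α j s T

        fixed-by-outer : ∀ b → isIJ α j s (V b) ≡ true → interchange α i r V b ≡ V b
        fixed-by-outer b l∈ = interchange-outside i r V b (pairs-disjoint i≢j r≢s (V b) l∈)

        fixed-by-inner : ∀ b → isIJ α j s (V b) ≡ false → V b ≡ T b
        fixed-by-inner b l∉ =
          interchange-outside j s T b (trans (sym (interchange-preserves-pair j s T b)) l∉)

        collision : ∀ b b' → V b ≡ V b' →
          interchange α i r V b ≡ interchange α i r V b' ⊎ T b ≡ T b'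
        collision b b' Vb≡Vb' with isIJ α j s (V b) in pair?
        ... | true  = inj₁ (trans (fixed-by-outer b pair?)
                             (trans Vb≡Vb' (sym (fixed-by-outer b' (trans (cong (isIJ α j s) (sym Vb≡Vb')) pair?)))))
        ... | false = inj₂ (trans (sym (fixed-by-inner b pair?))
                             (trans Vb≡Vb' (fixed-by-inner b' (trans (cong (isIJ α j s) (sym Vb≡Vb')) pair?))))

module Guarded {p q : ℕ} (α : Shape) where

  guarded : (Filling p q → Filling p q) → MixedTableau p q → MixedTableau p q
  guarded F nothing  = nothing
  guarded F (just T) with validFilling? α (F T)
  ... | yes _ = just (F T)
  ... | no  _ = nothing

  switch≡guarded : ∀ i r m → switch α i r m ≡ guarded (interchange α i r) m
  switch≡guarded i r nothing = refl
  switch≡guarded i r (just T) with validFilling? α (interchange α i r T)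
  ... | yes _ = refl
  ... | no  _ = refl

  module _ (F : Filling p q → Filling p q) (T : Filling p q) where

    guarded-valid : ValidFilling α (F T) → guarded F (just T) ≡ just (F T)
    guarded-valid FT-valid with validFilling? α (F T)
    ... | yes _         = refl
    ... | no  FT-invalid = ⊥-elim (FT-invalid FT-valid)

    guarded-invalid : ¬ ValidFilling α (F T) → guarded F (just T) ≡ nothing
    guarded-invalid FT-invalid with validFilling? α (F T)
    ... | yes FT-valid = ⊥-elim (FT-invalid FT-valid)
    ... | no  _        = refl

  module _ (F G : Filling p q → Filling p q) (T : Filling p q) where

    composite-valid : ValidFilling α (G T) → ValidFilling α (F (G T)) →
      guarded F (guarded G (just T)) ≡ just (F (G T))
    composite-valid GT-valid FGT-valid =
      trans (cong (guarded F) (guarded-valid G T GT-valid)) (guarded-valid F (G T) FGT-valid)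

    composite-invalid : ¬ ValidFilling α (F (G T)) → guarded F (guarded G (just T)) ≡ nothing
    composite-invalid FGT-invalid with validFilling? α (G T)
    ... | yes _ = guarded-invalid F (G T) FGT-invalid
    ... | no  _ = refl

  guarded-commute : (F G : Filling p q → Filling p q) →
    (∀ T b → F (G T) b ≡ G (F T) b) →
    (∀ T → ValidFilling α T → ValidFilling α (F (G T)) → ValidFilling α (G T)) →
    (∀ T → ValidFilling α T → ValidFilling α (G (F T)) → ValidFilling α (F T)) →
    ∀ m → InMixedtab α m → guarded F (guarded G m) ≈[ α ] guarded G (guarded F m)
  guarded-commute F G commute G-inner F-inner nothing  _       = null≈
  guarded-commute F G commute G-inner F-inner (just T) T-valid with validFilling? α (F (G T))
  ... | yes FGT-valid =
    subst₂ (λ x y → x ≈[ α ] y)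
      (sym (composite-valid F G T (G-inner T T-valid FGT-valid) FGT-valid))
      (sym (composite-valid G F T (F-inner T T-valid GFT-valid) GFT-valid))
      (fill≈ (λ b _ → commute T b))
    where
      GFT-valid : ValidFilling α (G (F T))
      GFT-valid = valid-≗ α (commute T) FGT-valid
  ... | no FGT-invalid =
    subst₂ (λ x y → x ≈[ α ] y)
      (sym (composite-invalid F G T FGT-invalid))
      (sym (composite-invalid G F T (FGT-invalid ∘ valid-≗ α (sym ∘ commute T))))
      null≈

lemma4p4 : (α : Shape) (p q : ℕ) → p ≥ 1 → q ≥ 1 →
    (i j : Fin p) → i ≢ j → (r s : Fin q) → r ≢ s →
    (T : MixedTableau p q) → InMixedtab α T →
    switch α i r (switch α j s T) ≈[ α ] switch α j s (switch α i r T)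
lemma4p4 α p q _ _ i j i≢j r s r≢s T T-valid =
  subst₂ (λ x y → x ≈[ α ] y) (sym (switch-twice i r j s)) (sym (switch-twice j s i r))
    (guarded-commute (interchange α i r) (interchange α j s)
      (interchange-commute i≢j r≢s)
      (inner-valid i≢j r≢s)
      (inner-valid (i≢j ∘ sym) (r≢s ∘ sym))
      T T-valid)
  where
    open Guarded {p} {q} α
    open Interchange {p} {q} α

    switch-twice : ∀ i r j s →
      switch α i r (switch α j s T) ≡ guarded (interchange α i r) (guarded (interchange α j s) T)
    switch-twice i r j s =
      trans (switch≡guarded i r (switch α j s T)) (cong (guarded (interchange α i r)) (switch≡guarded j s T))
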